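{- For $a \in \bar{\mathbb{Q}}$ let $C_{224,a} \subset \mathbb{P}^4$, with homogeneous coordinates $(q:r:s:t:z)$, be the curve \[ V\big(az^2 - t^2 - (tz - s^2),\; az^2 - t^2 - (sz - q^2),\; az^2 - t^2 - (-sz - r^2)\big). \] The values $a$ for which $C_{224,a}$ is singular are exactly $a \in \{ -\tfrac14, 0, a_1, a_2, a_3\}$, where $a_1, a_2, a_3$ are the three $3^{\mathrm{rd}}$ critical values of $f_c$.
   Context: $f_c(x) = x^2 + c$. An element $a$ is an $N^{\mathrm{th}}$ critical value of $f_c$ if there exists $c_0$ with $f_{c_0}^N(0) = a$ and $\frac{d}{dc} f_c^N(0)|_{c=c_0} = 0$. The three $3^{\mathrm{rd}}$ critical values are $a = (c^2+c)^2 + c$ for $c$ a root of $4c^3 + 6c^2 + 2c + 1$. The curve $C_{224,a}$ parametrizes $c$ for which $a$ has rational pre-images $\pm t$, $\pm s$ (with $s^2 + c = t$), and $\pm q, \pm r$ (with $q^2 + c = s$, $r^2 + c = -s$). -}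

module Defs where

open import Level using (Level; _⊔_) renaming (suc to lsuc)
open import Data.Nat using (ℕ; zero) renaming (suc to sucℕ)
open import Data.Integer using (ℤ; +_; -[1+_])
open import Data.Fin using (Fin; zero; suc; _≟_)
open import Data.Vec using (Vec; []; _∷_)
open import Data.Product using (Σ; ∃; ∃-syntax; _×_; _,_)
open import Data.Sum using (_⊎_)
open import Relation.Nullary using (¬_; yes; no)
open import Relation.Binary using (Decidable)
open import Algebra.Bundles using (CommutativeRing)

module RingOps {c ℓ} (R : CommutativeRing c ℓ) where
  open CommutativeRing R hiding (zero)
  natK : ℕ → Carrier
  natK zero = 0#
  natK (sucℕ n) = 1# + natK n
  intK : ℤ → Carrier
  intK (+ n) = natK n
  intK -[1+ n ] = - natK (sucℕ n)
  evalV : ∀ {n} → Vec Carrier n → Carrier → Carrier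
  evalV [] x = 0#
  evalV (c ∷ cs) x = c + x * evalV cs x
  pow : Carrier → ℕ → Carrier
  pow x zero = 1#
  pow x (sucℕ n) = x * pow x n

-- A field with decidable equality, characteristic 0, algebraically closed.
-- (Q̄ is such a field.)
record AlgClosedChar0Field c ℓ : Set (lsuc (c ⊔ ℓ)) where
  field
    cring : CommutativeRing c ℓ
  open CommutativeRing cring hiding (zero)
  open RingOps cring
  field
    nontrivial : ¬ (1# ≈ 0#)
    inverse    : ∀ x → ¬ (x ≈ 0#) → ∃[ y ] (x * y ≈ 1#)
    decEq      : Decidable _≈_
    char0      : ∀ n → ¬ (natK (sucℕ n) ≈ 0#)
    algClosed  : ∀ n (cs : Vec Carrier (sucℕ n)) →
                 ∃[ x ] (pow x (sucℕ n) + evalV cs x ≈ 0#)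
  open CommutativeRing cring public hiding (zero)
  open RingOps cring public

module _ {c ℓ} (K : AlgClosedChar0Field c ℓ) where
  open AlgClosedChar0Field K

  -- a is algebraic over ℚ: root of a polynomial with integer coefficients
  -- and nonzero leading coefficient (clearing denominators).
  evalZ : ∀ {n} → Vec ℤ n → Carrier → Carrier
  evalZ [] x = 0#
  evalZ (k ∷ ks) x = intK k + x * evalZ ks x

  IsAlgebraic : Carrier → Set ℓ
  IsAlgebraic a = ∃[ n ] Σ (Vec ℤ n) λ ks → Σ ℤ λ lead →
    ¬ (lead ≡ + 0) × (pow a n * intK lead + evalZ ks a ≈ 0#)
    where open import Relation.Binary.PropositionalEquality using (_≡_)

  data Poly : Set c where
    var  : Fin 5 → Poly
    con  : Carrier → Poly
    _⊕_  : Poly → Poly → Poly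
    _⊗_  : Poly → Poly → Poly
    ⊖_   : Poly → Poly

  evalP : Poly → (Fin 5 → Carrier) → Carrier
  evalP (var i) P = P i
  evalP (con k) P = k
  evalP (f ⊕ g) P = evalP f P + evalP g P
  evalP (f ⊗ g) P = evalP f P * evalP g P
  evalP (⊖ f) P = - evalP f P

  ∂ : Fin 5 → Poly → Poly
  ∂ i (var j) with i ≟ j
  ... | yes _ = con 1#
  ... | no _  = con 0#
  ∂ i (con _) = con 0#
  ∂ i (f ⊕ g) = ∂ i f ⊕ ∂ i g
  ∂ i (f ⊗ g) = (∂ i f ⊗ g) ⊕ (f ⊗ ∂ i g)
  ∂ i (⊖ f) = ⊖ ∂ i f

  _⊝_ : Poly → Poly → Poly
  f ⊝ g = f ⊕ (⊖ g)

  q r s t z : Poly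
  q = var zero
  r = var (suc zero)
  s = var (suc (suc zero))
  t = var (suc (suc (suc zero)))
  z = var (suc (suc (suc (suc zero))))

  eqs : Carrier → Fin 3 → Poly
  eqs a zero = ((con a ⊗ (z ⊗ z)) ⊝ (t ⊗ t)) ⊝ ((t ⊗ z) ⊝ (s ⊗ s))
  eqs a (suc zero) = ((con a ⊗ (z ⊗ z)) ⊝ (t ⊗ t)) ⊝ ((s ⊗ z) ⊝ (q ⊗ q))
  eqs a (suc (suc zero)) = ((con a ⊗ (z ⊗ z)) ⊝ (t ⊗ t)) ⊝ (((⊖ s) ⊗ z) ⊝ (r ⊗ r))

  sum3 : (Fin 3 → Carrier) → Carrier
  sum3 f = f zero + (f (suc zero) + f (suc (suc zero)))

  -- C_{224,a} is singular: there is a point P ∈ ℙ⁴ on the curve at which the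
  -- Jacobian of the three equations has rank < 3 (gradients linearly dependent).
  IsSingular : Carrier → Set (c ⊔ ℓ)
  IsSingular a = Σ (Fin 5 → Carrier) λ P →
      ¬ (∀ i → P i ≈ 0#)
    × (∀ k → evalP (eqs a k) P ≈ 0#)
    × Σ (Fin 3 → Carrier) λ λs →
        ¬ (∀ k → λs k ≈ 0#)
      × (∀ i → sum3 (λ k → λs k * evalP (∂ i (eqs a k)) P) ≈ 0#)

  f : Carrier → Carrier → Carrier
  f c x = x * x + c

  -- d/dc f_c³(0) = d/dc ((c²+c)²+c) = 2(c²+c)(2c+1) + 1
  df3 : Carrier → Carrier
  df3 c = (natK 2 * (c * c + c)) * (natK 2 * c + 1#) + 1#

  IsCriticalValue3 : Carrier → Set (c ⊔ ℓ)
  IsCriticalValue3 a = ∃[ c₀ ] (f c₀ (f c₀ (f c₀ 0#)) ≈ a × df3 c₀ ≈ 0#)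

  -- a ∈ {-1/4, 0, a₁, a₂, a₃}   (a = -1/4 written as 4a + 1 = 0)
  Exceptional : Carrier → Set (c ⊔ ℓ)
  Exceptional a = (natK 4 * a + 1# ≈ 0#) ⊎ (a ≈ 0#) ⊎ IsCriticalValue3 a

module Submission where

-- A singular point has z ≠ 0: at z = 0 the equations force q² = r² = s² = t², and then either the
-- point vanishes or the q-, r- and s-columns of the Jacobian kill all three multipliers.  The q- and
-- r-columns are 2q·μ₂ and 2r·μ₃, so μ₂ = 0 unless q = 0 and μ₃ = 0 unless r = 0.  If q, r ≠ 0, the
-- t- and z-columns give z = −2t and t = 2az, hence 4a + 1 = 0.  If q = r = 0, the equations give
-- s = t = 0 and a = 0.  If exactly one of q, r vanishes, put c = ±s/z and T = t/z: the equations
-- read T = c² + c and a = T² + c = f_c³(0), and the surviving Jacobian condition is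
-- 2T(2c + 1) + 1 = d/dc f_c³(0) = 0.  Conversely (0:0:0:0:1), (√2:√2:0:−1:2) and
-- (0:√(−2c):c:c²+c:1) are singular points in the three exceptional cases.

open import Defs hiding (q; r; s; t; z)
open import Algebra.Bundles using (CommutativeRing)
open import Algebra.Solver.Ring.AlmostCommutativeRing
  using (_-Raw-AlmostCommutative⟶_; fromCommutativeRing)
open import Data.Fin using (Fin; zero; suc; #_; _↑ˡ_; _≟_)
open import Data.Integer.Base as ℤ using (ℤ; +_; -[1+_]; _⊖_)
import Data.Integer.Properties as ℤ
open import Data.Maybe.Base using (Maybe; just; nothing)
import Data.Nat.Base as ℕ
import Data.Nat.Properties as ℕ
open import Data.Product using (_,_; ∃-syntax)
open import Data.Sum using (inj₁; inj₂)
open import Data.Vec.Base using (Vec; []; _∷_; lookup)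
open import Function.Bundles using (_⇔_; mk⇔)
open import Relation.Binary.PropositionalEquality.Core as ≡ using (cong)
open import Relation.Nullary using (¬_; yes; no)

module IntegerCoefficients {c ℓ} (R : CommutativeRing c ℓ) where
  open CommutativeRing R
  open import Algebra.Properties.Ring ring
    using (-‿involutive; -0#≈0#; -‿+-comm; -‿distribˡ-*; -‿distribʳ-*; xyx⁻¹≈y)
  open import Algebra.Properties.Semiring.Mult.TCOptimised semiring
    using (_×_; ×-homo-+; ×1-homo-*; 1+×)
  open import Relation.Binary.Reasoning.Setoid setoid

  -- The multiple _×_ is the type-checking-optimised one, so fromℤ (+ 1) and fromℤ (+ 2) reduce to
  -- 1# and 1# + 1#; the definitional matches with Defs in jacobian≈gradient rely on this.
  fromℤ : ℤ → Carrier
  fromℤ (+ n)    = n × 1#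
  fromℤ -[1+ n ] = - (ℕ.suc n × 1#)

  fromℤ-⊖ : ∀ m n → fromℤ (m ⊖ n) ≈ m × 1# - n × 1#
  fromℤ-⊖ ℕ.zero    ℕ.zero    = sym (-‿inverseʳ 0#)
  fromℤ-⊖ ℕ.zero    (ℕ.suc n) = sym (+-identityˡ _)
  fromℤ-⊖ (ℕ.suc m) ℕ.zero    = sym (trans (+-congˡ -0#≈0#) (+-identityʳ _))
  fromℤ-⊖ (ℕ.suc m) (ℕ.suc n) = begin
    fromℤ (ℕ.suc m ⊖ ℕ.suc n)           ≡⟨ cong fromℤ (ℤ.[1+m]⊖[1+n]≡m⊖n m n) ⟩
    fromℤ (m ⊖ n)                       ≈⟨ fromℤ-⊖ m n ⟩
    m × 1# - n × 1#                     ≈⟨ +-congʳ (xyx⁻¹≈y 1# (m × 1#)) ⟨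
    1# + m × 1# - 1# - n × 1#           ≈⟨ +-assoc _ _ _ ⟩
    1# + m × 1# + (- 1# - n × 1#)       ≈⟨ +-cong (1+× m 1#) (trans (-‿cong (1+× n 1#)) (sym (-‿+-comm _ _))) ⟨
    ℕ.suc m × 1# - ℕ.suc n × 1#         ∎

  fromℤ-+ : ∀ i j → fromℤ (i ℤ.+ j) ≈ fromℤ i + fromℤ j
  fromℤ-+ -[1+ m ] -[1+ n ] = begin
    - (ℕ.suc (ℕ.suc (m ℕ.+ n)) × 1#)         ≡⟨ cong (λ k → - (ℕ.suc k × 1#)) (ℕ.+-suc m n) ⟨
    - ((ℕ.suc m ℕ.+ ℕ.suc n) × 1#)          ≈⟨ -‿cong (×-homo-+ 1# (ℕ.suc m) (ℕ.suc n)) ⟩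
    - (ℕ.suc m × 1# + ℕ.suc n × 1#)         ≈⟨ -‿+-comm _ _ ⟨
    - (ℕ.suc m × 1#) + - (ℕ.suc n × 1#)     ∎
  fromℤ-+ -[1+ m ] (+ n)    = trans (fromℤ-⊖ n (ℕ.suc m)) (+-comm _ _)
  fromℤ-+ (+ m)    -[1+ n ] = fromℤ-⊖ m (ℕ.suc n)
  fromℤ-+ (+ m)    (+ n)    = ×-homo-+ 1# m n

  fromℤ-neg : ∀ i → fromℤ (ℤ.- i) ≈ - fromℤ i
  fromℤ-neg (+ ℕ.zero)  = sym -0#≈0#
  fromℤ-neg (+ ℕ.suc n) = refl
  fromℤ-neg -[1+ n ]    = sym (-‿involutive _)

  fromℤ-*-pos : ∀ m j → fromℤ (+ m ℤ.* j) ≈ m × 1# * fromℤ j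
  fromℤ-*-pos m (+ n) = begin
    fromℤ (+ m ℤ.* + n)   ≡⟨ cong fromℤ (ℤ.pos-* m n) ⟨
    (m ℕ.* n) × 1#        ≈⟨ ×1-homo-* m n ⟩
    m × 1# * n × 1#       ∎
  fromℤ-*-pos m -[1+ n ] = begin
    fromℤ (+ m ℤ.* -[1+ n ])               ≡⟨ cong fromℤ (ℤ.neg-distribʳ-* (+ m) (+ ℕ.suc n)) ⟨
    fromℤ (ℤ.- (+ m ℤ.* + ℕ.suc n))        ≈⟨ fromℤ-neg (+ m ℤ.* + ℕ.suc n) ⟩
    - fromℤ (+ m ℤ.* + ℕ.suc n)            ≈⟨ -‿cong (fromℤ-*-pos m (+ ℕ.suc n)) ⟩
    - (m × 1# * ℕ.suc n × 1#)              ≈⟨ -‿distribʳ-* _ _ ⟩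
    m × 1# * - (ℕ.suc n × 1#)              ∎

  fromℤ-* : ∀ i j → fromℤ (i ℤ.* j) ≈ fromℤ i * fromℤ j
  fromℤ-* (+ m)    j = fromℤ-*-pos m j
  fromℤ-* -[1+ m ] j = begin
    fromℤ (-[1+ m ] ℤ.* j)               ≡⟨ cong fromℤ (ℤ.neg-distribˡ-* (+ ℕ.suc m) j) ⟨
    fromℤ (ℤ.- (+ ℕ.suc m ℤ.* j))        ≈⟨ fromℤ-neg (+ ℕ.suc m ℤ.* j) ⟩
    - fromℤ (+ ℕ.suc m ℤ.* j)            ≈⟨ -‿cong (fromℤ-*-pos (ℕ.suc m) j) ⟩
    - (ℕ.suc m × 1# * fromℤ j)           ≈⟨ -‿distribˡ-* _ _ ⟩
    - (ℕ.suc m × 1#) * fromℤ j           ∎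

  homomorphism : ℤ.+-*-rawRing -Raw-AlmostCommutative⟶ fromCommutativeRing R
  homomorphism = record
    { ⟦_⟧    = fromℤ
    ; +-homo = fromℤ-+
    ; *-homo = fromℤ-*
    ; -‿homo = fromℤ-neg
    ; 0-homo = refl
    ; 1-homo = refl
    }

  fromℤ-≟ : ∀ i j → Maybe (fromℤ i ≈ fromℤ j)
  fromℤ-≟ i j with i ℤ.≟ j
  ... | yes ≡.refl = just refl
  ... | no _       = nothing

  open import Algebra.Solver.Ring ℤ.+-*-rawRing (fromCommutativeRing R) homomorphism fromℤ-≟ public

module _ {c ℓ} (K : AlgClosedChar0Field c ℓ) where
  open AlgClosedChar0Field K
  open IntegerCoefficients cring
  open import Algebra.Properties.Ring ring using (x∙y⁻¹≈ε⇒x≈y; x≈y⇒x∙y⁻¹≈ε; -0#≈0#)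
  open import Algebra.Properties.Semiring.Mult.TCOptimised semiring using (_×_; 1+×)
  open import Relation.Binary.Reasoning.Setoid setoid

  -- Every algebraic step below is an identity x ≈ Σ cᵢ * hᵢ proved by the solver, followed by a
  -- proof that each hᵢ vanishes, assembled with these combinators.
  infixl 6 _+₀_
  infix  9 -₀_ ·₀_

  _+₀_ : ∀ {x y} → x ≈ 0# → y ≈ 0# → x + y ≈ 0#
  x≈0 +₀ y≈0 = trans (+-cong x≈0 y≈0) (+-identityʳ 0#)

  -₀_ : ∀ {x} → x ≈ 0# → - x ≈ 0#
  -₀ x≈0 = trans (-‿cong x≈0) -0#≈0#

  ·₀_ : ∀ {x y} → y ≈ 0# → x * y ≈ 0#
  ·₀ y≈0 = trans (*-congˡ y≈0) (zeroʳ _)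

  natK≈× : ∀ n → natK n ≈ n × 1#
  natK≈× ℕ.zero    = refl
  natK≈× (ℕ.suc n) = trans (+-congˡ (natK≈× n)) (sym (1+× n 1#))

  2≉0 : ¬ 2 × 1# ≈ 0#
  2≉0 2≈0 = char0 1 (trans (natK≈× 2) 2≈0)

  x*y≈0⇒y≈0 : ∀ {x y} → ¬ x ≈ 0# → x * y ≈ 0# → y ≈ 0#
  x*y≈0⇒y≈0 {x} {y} x≉0 xy≈0 with inverse x x≉0
  ... | w , xw≈1 = begin
    y             ≈⟨ *-identityˡ y ⟨
    1# * y        ≈⟨ *-congʳ xw≈1 ⟨
    x * w * y     ≈⟨ *-congʳ (*-comm x w) ⟩
    w * x * y     ≈⟨ *-assoc w x y ⟩
    w * (x * y)   ≈⟨ ·₀ xy≈0 ⟩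
    0#            ∎

  x*y≈0⇒x≈0 : ∀ {x y} → ¬ y ≈ 0# → x * y ≈ 0# → x ≈ 0#
  x*y≈0⇒x≈0 y≉0 xy≈0 = x*y≈0⇒y≈0 y≉0 (trans (*-comm _ _) xy≈0)

  x≉0∧y≉0⇒x*y≉0 : ∀ {x y} → ¬ x ≈ 0# → ¬ y ≈ 0# → ¬ x * y ≈ 0#
  x≉0∧y≉0⇒x*y≉0 x≉0 y≉0 xy≈0 = y≉0 (x*y≈0⇒y≈0 x≉0 xy≈0)

  x*x≈y*y⇒y≈0⇒x≈0 : ∀ {x y} → x * x ≈ y * y → y ≈ 0# → x ≈ 0#
  x*x≈y*y⇒y≈0⇒x≈0 {x} xx≈yy y≈0 with decEq x 0#
  ... | yes x≈0 = x≈0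
  ... | no  x≉0 = x*y≈0⇒y≈0 x≉0 (trans xx≈yy (·₀ y≈0))

  square-root : ∀ x → ∃[ y ] y * y ≈ x
  square-root x with algClosed 1 (- x ∷ 0# ∷ [])
  ... | y , root = y , x∙y⁻¹≈ε⇒x≈y _ _ (trans (y*y-x≈poly y x) root)
    where
    y*y-x≈poly : ∀ y x → y * y - x ≈ pow y 2 + evalV (- x ∷ 0# ∷ []) y
    y*y-x≈poly = solve 2 (λ y x →
      y :* y :- x := y :* (y :* con (+ 1)) :+ (:- x :+ y :* (con (+ 0) :+ y :* con (+ 0)))) refl

  -- ∂ˢ and eqsˢ transcribe ∂ and eqs into solver syntax clause by clause, so that ⟦_⟧ of the
  -- transcription is definitionally evalP of the original at every concrete index.
  ∂ˢ : ∀ {n} → Fin n → Polynomial n → Polynomial n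
  ∂ˢ i (op [+] f g)     = ∂ˢ i f :+ ∂ˢ i g
  ∂ˢ i (op [*] f g)     = ∂ˢ i f :* g :+ f :* ∂ˢ i g
  ∂ˢ i (con _)          = con (+ 0)
  ∂ˢ i (var j) with i ≟ j
  ... | yes _ = con (+ 1)
  ... | no _  = con (+ 0)
  ∂ˢ i (f :^ ℕ.zero)    = con (+ 0)
  ∂ˢ i (f :^ ℕ.suc n)   = con (+ ℕ.suc n) :* f :^ n :* ∂ˢ i f
  ∂ˢ i (:- f)           = :- ∂ˢ i f

  eqsˢ : ∀ {n} (a q r s t z : Polynomial n) → Fin 3 → Polynomial n
  eqsˢ a q r s t z zero             = a :* (z :* z) :- t :* t :- (t :* z :- s :* s)
  eqsˢ a q r s t z (suc zero)       = a :* (z :* z) :- t :* t :- (s :* z :- q :* q)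
  eqsˢ a q r s t z (suc (suc zero)) = a :* (z :* z) :- t :* t :- (:- s :* z :- r :* r)

  gradientˢ : ∀ {n} (a q r s t z μ₁ μ₂ μ₃ : Polynomial n) → Fin 5 → Polynomial n
  gradientˢ a q r s t z μ₁ μ₂ μ₃ zero                         =
    μ₂ :* (con (+ 2) :* q)
  gradientˢ a q r s t z μ₁ μ₂ μ₃ (suc zero)                   =
    μ₃ :* (con (+ 2) :* r)
  gradientˢ a q r s t z μ₁ μ₂ μ₃ (suc (suc zero))             =
    con (+ 2) :* μ₁ :* s :- μ₂ :* z :+ μ₃ :* z
  gradientˢ a q r s t z μ₁ μ₂ μ₃ (suc (suc (suc zero)))       =
    :- (μ₁ :* (con (+ 2) :* t :+ z) :+ con (+ 2) :* t :* μ₂ :+ con (+ 2) :* t :* μ₃)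
  gradientˢ a q r s t z μ₁ μ₂ μ₃ (suc (suc (suc (suc zero)))) =
    μ₁ :* (con (+ 2) :* a :* z :- t) :+ μ₂ :* (con (+ 2) :* a :* z :- s) :+ μ₃ :* (con (+ 2) :* a :* z :+ s)

  Q R S T Z A M₁ M₂ M₃ : Polynomial 9
  Q  = var (# 0)
  R  = var (# 1)
  S  = var (# 2)
  T  = var (# 3)
  Z  = var (# 4)
  A  = var (# 5)
  M₁ = var (# 6)
  M₂ = var (# 7)
  M₃ = var (# 8)

  Eᵛ : Fin 3 → Polynomial 9
  Eᵛ = eqsˢ A Q R S T Z

  Gᵛ : Fin 5 → Polynomial 9
  Gᵛ = gradientˢ A Q R S T Z M₁ M₂ M₃

  jacobianᵛ : Fin 5 → Polynomial 9
  jacobianᵛ i = M₁ :* ∂E zero :+ (M₂ :* ∂E (suc zero) :+ M₃ :* ∂E (suc (suc zero)))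
    where
    ∂E : Fin 3 → Polynomial 9
    ∂E k = ∂ˢ (i ↑ˡ 4) (Eᵛ k)

  env : Carrier → (Fin 5 → Carrier) → (Fin 3 → Carrier) → Vec Carrier 9
  env a P μ = P (# 0) ∷ P (# 1) ∷ P (# 2) ∷ P (# 3) ∷ P (# 4) ∷ a ∷
              μ (# 0) ∷ μ (# 1) ∷ μ (# 2) ∷ []

  gradient : Carrier → (Fin 5 → Carrier) → (Fin 3 → Carrier) → Fin 5 → Carrier
  gradient a P μ i = ⟦ Gᵛ i ⟧ (env a P μ)

  jacobian≈gradient : ∀ a P μ i →
    sum3 K (λ k → μ k * evalP K (∂ K i (eqs K a k)) P) ≈ gradient a P μ i
  jacobian≈gradient a P μ zero                         = prove (env a P μ) (jacobianᵛ (# 0)) (Gᵛ (# 0)) refl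
  jacobian≈gradient a P μ (suc zero)                   = prove (env a P μ) (jacobianᵛ (# 1)) (Gᵛ (# 1)) refl
  jacobian≈gradient a P μ (suc (suc zero))             = prove (env a P μ) (jacobianᵛ (# 2)) (Gᵛ (# 2)) refl
  jacobian≈gradient a P μ (suc (suc (suc zero)))       = prove (env a P μ) (jacobianᵛ (# 3)) (Gᵛ (# 3)) refl
  jacobian≈gradient a P μ (suc (suc (suc (suc zero)))) = prove (env a P μ) (jacobianᵛ (# 4)) (Gᵛ (# 4)) refl

  fˢ : ∀ {n} → Polynomial n → Polynomial n → Polynomial n
  fˢ c x = x :* x :+ c

  df3≈ : ∀ c → df3 K c ≈ 2 × 1# * (c * c + c) * (2 × 1# * c + 1#) + 1#
  df3≈ c = +-congʳ (*-cong (*-congʳ (natK≈× 2)) (+-congʳ (*-congʳ (natK≈× 2))))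

  critical-value-intro : ∀ {a} c T → c * c + c - T ≈ 0# → T * T + c - a ≈ 0# →
                         2 × 1# * T * (2 × 1# * c + 1#) + 1# ≈ 0# → IsCriticalValue3 K a
  critical-value-intro {a} c T X≈0 Y≈0 D≈0 =
    c , orbit , trans (df3≈ c) (trans derivative (D≈0 +₀ ·₀ X≈0))
    where
    orbit : f K c (f K c (f K c 0#)) ≈ a
    orbit = x∙y⁻¹≈ε⇒x≈y _ _ (trans (solve 3 (λ c T a →
      fˢ c (fˢ c (fˢ c (con (+ 0)))) :- a := (c :* c :+ c :+ T) :* (c :* c :+ c :- T) :+ (T :* T :+ c :- a))
      refl c T a) (·₀ X≈0 +₀ Y≈0))
    derivative : 2 × 1# * (c * c + c) * (2 × 1# * c + 1#) + 1# ≈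
                 2 × 1# * T * (2 × 1# * c + 1#) + 1# + 2 × 1# * (2 × 1# * c + 1#) * (c * c + c - T)
    derivative = solve 2 (λ c T →
      con (+ 2) :* (c :* c :+ c) :* (con (+ 2) :* c :+ con (+ 1)) :+ con (+ 1) :=
      con (+ 2) :* T :* (con (+ 2) :* c :+ con (+ 1)) :+ con (+ 1)
        :+ con (+ 2) :* (con (+ 2) :* c :+ con (+ 1)) :* (c :* c :+ c :- T))
      refl c T

  -- Dehomogenise at z = 1: c = σ/z and T = t/z.
  critical-value-from-chart : ∀ {a σ t z} → ¬ z ≈ 0# →
    t * z - σ * σ - σ * z ≈ 0# → a * (z * z) - t * t - σ * z ≈ 0# →
    z * z + 2 × 1# * t * z + 4 × 1# * t * σ ≈ 0# → IsCriticalValue3 K a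
  critical-value-from-chart {a} {σ} {t} {z} z≉0 H₁ H₂ H₃ with inverse z z≉0
  ... | w , zw≈1 = critical-value-intro (σ * w) (t * w) X≈0 Y≈0 D≈0
    where
    zw-1≈0 : z * w - 1# ≈ 0#
    zw-1≈0 = x≈y⇒x∙y⁻¹≈ε zw≈1
    X≈0 : σ * w * (σ * w) + σ * w - t * w ≈ 0#
    X≈0 = trans (solve 4 (λ σ t z w →
      σ :* w :* (σ :* w) :+ σ :* w :- t :* w :=
      :- (w :* w) :* (t :* z :- σ :* σ :- σ :* z) :+ (t :* w :- σ :* w) :* (z :* w :- con (+ 1)))
      refl σ t z w) (·₀ H₁ +₀ ·₀ zw-1≈0)
    Y≈0 : t * w * (t * w) + σ * w - a ≈ 0#
    Y≈0 = trans (solve 5 (λ a σ t z w →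
      t :* w :* (t :* w) :+ σ :* w :- a :=
      :- (w :* w) :* (a :* (z :* z) :- t :* t :- σ :* z)
        :+ (a :* (con (+ 1) :+ z :* w) :- σ :* w) :* (z :* w :- con (+ 1)))
      refl a σ t z w) (·₀ H₂ +₀ ·₀ zw-1≈0)
    D≈0 : 2 × 1# * (t * w) * (2 × 1# * (σ * w) + 1#) + 1# ≈ 0#
    D≈0 = trans (solve 4 (λ σ t z w →
      con (+ 2) :* (t :* w) :* (con (+ 2) :* (σ :* w) :+ con (+ 1)) :+ con (+ 1) :=
      w :* w :* (z :* z :+ con (+ 2) :* t :* z :+ con (+ 4) :* t :* σ)
        :- (con (+ 2) :* t :* w :+ con (+ 1) :+ z :* w) :* (z :* w :- con (+ 1)))
      refl σ t z w) (·₀ H₃ +₀ -₀ ·₀ zw-1≈0)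

  module SingularPoint {a : Carrier} {P : Fin 5 → Carrier} {μ : Fin 3 → Carrier}
    (P≉0 : ¬ (∀ i → P i ≈ 0#)) (E≈0 : ∀ k → evalP K (eqs K a k) P ≈ 0#)
    (μ≉0 : ¬ (∀ k → μ k ≈ 0#)) (G≈0 : ∀ i → gradient a P μ i ≈ 0#) where

    q r s t z μ₁ μ₂ μ₃ : Carrier
    q  = P (# 0)
    r  = P (# 1)
    s  = P (# 2)
    t  = P (# 3)
    z  = P (# 4)
    μ₁ = μ (# 0)
    μ₂ = μ (# 1)
    μ₃ = μ (# 2)

    ρ : Vec Carrier 9
    ρ = env a P μ

    μ₂≈0 : ¬ q ≈ 0# → μ₂ ≈ 0#
    μ₂≈0 q≉0 = x*y≈0⇒x≈0 (x≉0∧y≉0⇒x*y≉0 2≉0 q≉0) (G≈0 (# 0))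

    μ₃≈0 : ¬ r ≈ 0# → μ₃ ≈ 0#
    μ₃≈0 r≉0 = x*y≈0⇒x≈0 (x≉0∧y≉0⇒x*y≉0 2≉0 r≉0) (G≈0 (# 1))

    q*q≈t*t-at-infinity : z ≈ 0# → q * q ≈ t * t
    q*q≈t*t-at-infinity z≈0 = x∙y⁻¹≈ε⇒x≈y _ _
      (trans (prove ρ (Q :* Q :- T :* T) (Eᵛ (# 1) :+ (S :- A :* Z) :* Z) refl) (E≈0 (# 1) +₀ ·₀ z≈0))

    r*r≈t*t-at-infinity : z ≈ 0# → r * r ≈ t * t
    r*r≈t*t-at-infinity z≈0 = x∙y⁻¹≈ε⇒x≈y _ _
      (trans (prove ρ (R :* R :- T :* T) (Eᵛ (# 2) :+ (:- S :- A :* Z) :* Z) refl) (E≈0 (# 2) +₀ ·₀ z≈0))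

    s*s≈t*t-at-infinity : z ≈ 0# → s * s ≈ t * t
    s*s≈t*t-at-infinity z≈0 = x∙y⁻¹≈ε⇒x≈y _ _
      (trans (prove ρ (S :* S :- T :* T) (Eᵛ (# 0) :+ (T :- A :* Z) :* Z) refl) (E≈0 (# 0) +₀ ·₀ z≈0))

    z≉0 : ¬ z ≈ 0#
    z≉0 z≈0 with decEq t 0#
    ... | yes t≈0 = P≉0 λ
      { zero                         → x*x≈y*y⇒y≈0⇒x≈0 (q*q≈t*t-at-infinity z≈0) t≈0
      ; (suc zero)                   → x*x≈y*y⇒y≈0⇒x≈0 (r*r≈t*t-at-infinity z≈0) t≈0
      ; (suc (suc zero))             → x*x≈y*y⇒y≈0⇒x≈0 (s*s≈t*t-at-infinity z≈0) t≈0
      ; (suc (suc (suc zero)))       → t≈0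
      ; (suc (suc (suc (suc zero)))) → z≈0
      }
    ... | no t≉0 = μ≉0 λ
      { zero             → x*y≈0⇒x≈0 (x≉0∧y≉0⇒x*y≉0 2≉0 (≉0 (s*s≈t*t-at-infinity z≈0))) μ₁2s≈0
      ; (suc zero)       → μ₂≈0 (≉0 (q*q≈t*t-at-infinity z≈0))
      ; (suc (suc zero)) → μ₃≈0 (≉0 (r*r≈t*t-at-infinity z≈0))
      }
      where
      ≉0 : ∀ {x} → x * x ≈ t * t → ¬ x ≈ 0#
      ≉0 xx≈tt x≈0 = t≉0 (x*x≈y*y⇒y≈0⇒x≈0 (sym xx≈tt) x≈0)
      μ₁2s≈0 : μ₁ * (2 × 1# * s) ≈ 0#
      μ₁2s≈0 = trans (prove ρ (M₁ :* (con (+ 2) :* S)) (Gᵛ (# 2) :+ (M₂ :- M₃) :* Z) refl)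
                     (G≈0 (# 2) +₀ ·₀ z≈0)

    4a+1≈0 : ¬ q ≈ 0# → ¬ r ≈ 0# → natK 4 * a + 1# ≈ 0#
    4a+1≈0 q≉0 r≉0 = trans (+-congʳ (*-congʳ (natK≈× 4))) (x*y≈0⇒y≈0 z≉0
      (trans (prove ρ (Z :* (con (+ 4) :* A :+ con (+ 1)))
                      (con (+ 2) :* (con (+ 2) :* A :* Z :- T) :+ (con (+ 2) :* T :+ Z)) refl)
             (·₀ 2az-t≈0 +₀ 2t+z≈0)))
      where
      μ₁≉0 : ¬ μ₁ ≈ 0#
      μ₁≉0 μ₁≈0 = μ≉0 λ { zero → μ₁≈0 ; (suc zero) → μ₂≈0 q≉0 ; (suc (suc zero)) → μ₃≈0 r≉0 }
      2t+z≈0 : 2 × 1# * t + z ≈ 0#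
      2t+z≈0 = x*y≈0⇒y≈0 μ₁≉0 (trans
        (prove ρ (M₁ :* (con (+ 2) :* T :+ Z))
                 (:- Gᵛ (# 3) :- con (+ 2) :* T :* M₂ :- con (+ 2) :* T :* M₃) refl)
        (-₀ G≈0 (# 3) +₀ -₀ ·₀ μ₂≈0 q≉0 +₀ -₀ ·₀ μ₃≈0 r≉0))
      2az-t≈0 : 2 × 1# * a * z - t ≈ 0#
      2az-t≈0 = x*y≈0⇒y≈0 μ₁≉0 (trans
        (prove ρ (M₁ :* (con (+ 2) :* A :* Z :- T))
                 (Gᵛ (# 4) :- (con (+ 2) :* A :* Z :- S) :* M₂ :- (con (+ 2) :* A :* Z :+ S) :* M₃) refl)
        (G≈0 (# 4) +₀ -₀ ·₀ μ₂≈0 q≉0 +₀ -₀ ·₀ μ₃≈0 r≉0))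

    a≈0 : q ≈ 0# → r ≈ 0# → a ≈ 0#
    a≈0 q≈0 r≈0 = x*y≈0⇒y≈0 (x≉0∧y≉0⇒x*y≉0 z≉0 z≉0)
      (trans (prove ρ (Z :* Z :* A) (Eᵛ (# 1) :+ T :* T :+ Z :* S :- Q :* Q) refl)
             (E≈0 (# 1) +₀ ·₀ t≈0 +₀ ·₀ s≈0 +₀ -₀ ·₀ q≈0))
      where
      s≈0 : s ≈ 0#
      s≈0 = x*y≈0⇒y≈0 (x≉0∧y≉0⇒x*y≉0 2≉0 z≉0)
        (trans (prove ρ (con (+ 2) :* Z :* S) (Eᵛ (# 2) :- Eᵛ (# 1) :+ Q :* Q :- R :* R) refl)
               (E≈0 (# 2) +₀ -₀ E≈0 (# 1) +₀ ·₀ q≈0 +₀ -₀ ·₀ r≈0))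
      t≈0 : t ≈ 0#
      t≈0 = x*y≈0⇒y≈0 z≉0
        (trans (prove ρ (Z :* T) (Eᵛ (# 1) :- Eᵛ (# 0) :+ S :* S :+ Z :* S :- Q :* Q) refl)
               (E≈0 (# 1) +₀ -₀ E≈0 (# 0) +₀ ·₀ s≈0 +₀ ·₀ s≈0 +₀ -₀ ·₀ q≈0))

    critical-value₊ : q ≈ 0# → ¬ r ≈ 0# → IsCriticalValue3 K a
    critical-value₊ q≈0 r≉0 = critical-value-from-chart z≉0
      (trans (prove ρ (T :* Z :- S :* S :- S :* Z) (Eᵛ (# 1) :- Eᵛ (# 0) :- Q :* Q) refl)
             (E≈0 (# 1) +₀ -₀ E≈0 (# 0) +₀ -₀ ·₀ q≈0))
      (trans (prove ρ (A :* (Z :* Z) :- T :* T :- S :* Z) (Eᵛ (# 1) :- Q :* Q) refl)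
             (E≈0 (# 1) +₀ -₀ ·₀ q≈0))
      (x*y≈0⇒y≈0 μ₁≉0 (trans
        (prove ρ (M₁ :* (Z :* Z :+ con (+ 2) :* T :* Z :+ con (+ 4) :* T :* S))
                 (:- Z :* Gᵛ (# 3) :+ con (+ 2) :* T :* Gᵛ (# 2) :- con (+ 4) :* T :* Z :* M₃) refl)
        (·₀ G≈0 (# 3) +₀ ·₀ G≈0 (# 2) +₀ -₀ ·₀ μ₃≈0 r≉0)))
      where
      μ₁≉0 : ¬ μ₁ ≈ 0#
      μ₁≉0 μ₁≈0 = μ≉0 λ { zero → μ₁≈0 ; (suc zero) → μ₂≈0′ ; (suc (suc zero)) → μ₃≈0 r≉0 }
        where
        μ₂≈0′ : μ₂ ≈ 0#
        μ₂≈0′ = x*y≈0⇒y≈0 z≉0 (trans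
          (prove ρ (Z :* M₂) (:- Gᵛ (# 2) :+ con (+ 2) :* S :* M₁ :+ Z :* M₃) refl)
          (-₀ G≈0 (# 2) +₀ ·₀ μ₁≈0 +₀ ·₀ μ₃≈0 r≉0))

    critical-value₋ : ¬ q ≈ 0# → r ≈ 0# → IsCriticalValue3 K a
    critical-value₋ q≉0 r≈0 = critical-value-from-chart z≉0
      (trans (prove ρ (T :* Z :- :- S :* :- S :- :- S :* Z) (Eᵛ (# 2) :- Eᵛ (# 0) :- R :* R) refl)
             (E≈0 (# 2) +₀ -₀ E≈0 (# 0) +₀ -₀ ·₀ r≈0))
      (trans (prove ρ (A :* (Z :* Z) :- T :* T :- :- S :* Z) (Eᵛ (# 2) :- R :* R) refl)
             (E≈0 (# 2) +₀ -₀ ·₀ r≈0))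
      (x*y≈0⇒y≈0 μ₁≉0 (trans
        (prove ρ (M₁ :* (Z :* Z :+ con (+ 2) :* T :* Z :+ con (+ 4) :* T :* :- S))
                 (:- Z :* Gᵛ (# 3) :- con (+ 2) :* T :* Gᵛ (# 2) :- con (+ 4) :* T :* Z :* M₂) refl)
        (·₀ G≈0 (# 3) +₀ -₀ ·₀ G≈0 (# 2) +₀ -₀ ·₀ μ₂≈0 q≉0)))
      where
      μ₁≉0 : ¬ μ₁ ≈ 0#
      μ₁≉0 μ₁≈0 = μ≉0 λ { zero → μ₁≈0 ; (suc zero) → μ₂≈0 q≉0 ; (suc (suc zero)) → μ₃≈0′ }
        where
        μ₃≈0′ : μ₃ ≈ 0#
        μ₃≈0′ = x*y≈0⇒y≈0 z≉0 (trans
          (prove ρ (Z :* M₃) (Gᵛ (# 2) :- con (+ 2) :* S :* M₁ :+ Z :* M₂) refl)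
          (G≈0 (# 2) +₀ -₀ ·₀ μ₁≈0 +₀ ·₀ μ₂≈0 q≉0))

    exceptional : Exceptional K a
    exceptional with decEq q 0# | decEq r 0#
    ... | no q≉0  | no r≉0  = inj₁ (4a+1≈0 q≉0 r≉0)
    ... | yes q≈0 | yes r≈0 = inj₂ (inj₁ (a≈0 q≈0 r≈0))
    ... | yes q≈0 | no r≉0  = inj₂ (inj₂ (critical-value₊ q≈0 r≉0))
    ... | no q≉0  | yes r≈0 = inj₂ (inj₂ (critical-value₋ q≉0 r≈0))

  singular⇒exceptional : ∀ {a} → IsSingular K a → Exceptional K a
  singular⇒exceptional {a} (P , P≉0 , E≈0 , μ , μ≉0 , J≈0) =
    SingularPoint.exceptional P≉0 E≈0 μ≉0 (λ i → trans (sym (jacobian≈gradient a P μ i)) (J≈0 i))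

  singular-intro : ∀ {a} (P : Fin 5 → Carrier) (μ : Fin 3 → Carrier) →
    ¬ (∀ i → P i ≈ 0#) → (∀ k → evalP K (eqs K a k) P ≈ 0#) →
    ¬ (∀ k → μ k ≈ 0#) → (∀ i → gradient a P μ i ≈ 0#) → IsSingular K a
  singular-intro P μ P≉0 E≈0 μ≉0 G≈0 =
    P , P≉0 , E≈0 , μ , μ≉0 , λ i → trans (jacobian≈gradient _ P μ i) (G≈0 i)

  module SyntacticPoint {n} (ρ : Vec Carrier n) (α : Polynomial n)
                 (Pˢ : Vec (Polynomial n) 5) (μˢ : Vec (Polynomial n) 3) where

    P : Fin 5 → Carrier
    P i = ⟦ lookup Pˢ i ⟧ ρ

    μ : Fin 3 → Carrier
    μ k = ⟦ lookup μˢ k ⟧ ρ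

    Eʷ : Fin 3 → Polynomial n
    Eʷ = eqsˢ α (lookup Pˢ (# 0)) (lookup Pˢ (# 1)) (lookup Pˢ (# 2)) (lookup Pˢ (# 3)) (lookup Pˢ (# 4))

    Gʷ : Fin 5 → Polynomial n
    Gʷ = gradientˢ α (lookup Pˢ (# 0)) (lookup Pˢ (# 1)) (lookup Pˢ (# 2)) (lookup Pˢ (# 3)) (lookup Pˢ (# 4))
                     (lookup μˢ (# 0)) (lookup μˢ (# 1)) (lookup μˢ (# 2))

  a≈0⇒singular : ∀ {a} → a ≈ 0# → IsSingular K a
  a≈0⇒singular {a} a≈0 =
    singular-intro P μ (λ P≈0 → nontrivial (P≈0 (# 4))) E≈0 (λ μ≈0 → nontrivial (μ≈0 (# 1))) G≈0
    where
    ρ : Vec Carrier 1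
    ρ = a ∷ []
    α O I : Polynomial 1
    α = var (# 0)
    O = con (+ 0)
    I = con (+ 1)
    open SyntacticPoint ρ α (O ∷ O ∷ O ∷ O ∷ I ∷ []) (O ∷ I ∷ I ∷ [])
    E≈0 : ∀ k → evalP K (eqs K a k) P ≈ 0#
    E≈0 zero             = trans (prove ρ (Eʷ (# 0)) α refl) a≈0
    E≈0 (suc zero)       = trans (prove ρ (Eʷ (# 1)) α refl) a≈0
    E≈0 (suc (suc zero)) = trans (prove ρ (Eʷ (# 2)) α refl) a≈0
    G≈0 : ∀ i → gradient a P μ i ≈ 0#
    G≈0 zero                         = prove ρ (Gʷ (# 0)) O refl
    G≈0 (suc zero)                   = prove ρ (Gʷ (# 1)) O refl
    G≈0 (suc (suc zero))             = prove ρ (Gʷ (# 2)) O refl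
    G≈0 (suc (suc (suc zero)))       = prove ρ (Gʷ (# 3)) O refl
    G≈0 (suc (suc (suc (suc zero)))) = trans (prove ρ (Gʷ (# 4)) (con (+ 4) :* α) refl) (·₀ a≈0)

  4a+1≈0⇒singular : ∀ {a} → natK 4 * a + 1# ≈ 0# → IsSingular K a
  4a+1≈0⇒singular {a} 4a+1≈0 with square-root (2 × 1#)
  ... | x , x*x≈2 =
    singular-intro P μ (λ P≈0 → 2≉0 (P≈0 (# 4))) E≈0 (λ μ≈0 → nontrivial (μ≈0 (# 0))) G≈0
    where
    ρ : Vec Carrier 2
    ρ = a ∷ x ∷ []
    α ξ O I : Polynomial 2
    α = var (# 0)
    ξ = var (# 1)
    O = con (+ 0)
    I = con (+ 1)
    open SyntacticPoint ρ α (ξ ∷ ξ ∷ O ∷ :- I ∷ con (+ 2) ∷ []) (I ∷ O ∷ O ∷ [])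
    4a+1≈0′ : 4 × 1# * a + 1# ≈ 0#
    4a+1≈0′ = trans (+-congʳ (*-congʳ (sym (natK≈× 4)))) 4a+1≈0
    x*x-2≈0 : x * x - 2 × 1# ≈ 0#
    x*x-2≈0 = x≈y⇒x∙y⁻¹≈ε x*x≈2
    E≈0 : ∀ k → evalP K (eqs K a k) P ≈ 0#
    E≈0 zero             = trans (prove ρ (Eʷ (# 0)) (con (+ 4) :* α :+ I) refl) 4a+1≈0′
    E≈0 (suc zero)       =
      trans (prove ρ (Eʷ (# 1)) (con (+ 4) :* α :+ I :+ (ξ :* ξ :- con (+ 2))) refl) (4a+1≈0′ +₀ x*x-2≈0)
    E≈0 (suc (suc zero)) =
      trans (prove ρ (Eʷ (# 2)) (con (+ 4) :* α :+ I :+ (ξ :* ξ :- con (+ 2))) refl) (4a+1≈0′ +₀ x*x-2≈0)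
    G≈0 : ∀ i → gradient a P μ i ≈ 0#
    G≈0 zero                         = prove ρ (Gʷ (# 0)) O refl
    G≈0 (suc zero)                   = prove ρ (Gʷ (# 1)) O refl
    G≈0 (suc (suc zero))             = prove ρ (Gʷ (# 2)) O refl
    G≈0 (suc (suc (suc zero)))       = prove ρ (Gʷ (# 3)) O refl
    G≈0 (suc (suc (suc (suc zero)))) = trans (prove ρ (Gʷ (# 4)) (con (+ 4) :* α :+ I) refl) 4a+1≈0′

  critical-value⇒singular : ∀ {a} → IsCriticalValue3 K a → IsSingular K a
  critical-value⇒singular {a} (c₀ , orbit , critical) with square-root (- (2 × 1# * c₀))
  ... | y , y*y≈-2c =
    singular-intro P μ (λ P≈0 → nontrivial (P≈0 (# 4))) E≈0 (λ μ≈0 → nontrivial (μ≈0 (# 0))) G≈0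
    where
    ρ : Vec Carrier 3
    ρ = a ∷ c₀ ∷ y ∷ []
    α γ η O I : Polynomial 3
    α = var (# 0)
    γ = var (# 1)
    η = var (# 2)
    O = con (+ 0)
    I = con (+ 1)
    open SyntacticPoint ρ α (O ∷ η ∷ γ ∷ γ :* γ :+ γ ∷ I ∷ []) (I ∷ con (+ 2) :* γ ∷ O ∷ [])
    f³-a≈0 : f K c₀ (f K c₀ (f K c₀ 0#)) - a ≈ 0#
    f³-a≈0 = x≈y⇒x∙y⁻¹≈ε orbit
    D≈0 : 2 × 1# * (c₀ * c₀ + c₀) * (2 × 1# * c₀ + 1#) + 1# ≈ 0#
    D≈0 = trans (sym (df3≈ c₀)) critical
    y*y+2c≈0 : y * y + 2 × 1# * c₀ ≈ 0#
    y*y+2c≈0 = trans (+-congʳ y*y≈-2c) (-‿inverseˡ _)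
    f³-aˢ Dˢ y*y+2cˢ : Polynomial 3
    f³-aˢ = fˢ γ (fˢ γ (fˢ γ O)) :- α
    Dˢ = con (+ 2) :* (γ :* γ :+ γ) :* (con (+ 2) :* γ :+ I) :+ I
    y*y+2cˢ = η :* η :+ con (+ 2) :* γ
    E≈0 : ∀ k → evalP K (eqs K a k) P ≈ 0#
    E≈0 zero             = trans (prove ρ (Eʷ (# 0)) (:- f³-aˢ) refl) (-₀ f³-a≈0)
    E≈0 (suc zero)       = trans (prove ρ (Eʷ (# 1)) (:- f³-aˢ) refl) (-₀ f³-a≈0)
    E≈0 (suc (suc zero)) =
      trans (prove ρ (Eʷ (# 2)) (:- f³-aˢ :+ y*y+2cˢ) refl) (-₀ f³-a≈0 +₀ y*y+2c≈0)
    G≈0 : ∀ i → gradient a P μ i ≈ 0#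
    G≈0 zero                         = prove ρ (Gʷ (# 0)) O refl
    G≈0 (suc zero)                   = prove ρ (Gʷ (# 1)) O refl
    G≈0 (suc (suc zero))             = prove ρ (Gʷ (# 2)) O refl
    G≈0 (suc (suc (suc zero)))       = trans (prove ρ (Gʷ (# 3)) (:- Dˢ) refl) (-₀ D≈0)
    G≈0 (suc (suc (suc (suc zero)))) =
      trans (prove ρ (Gʷ (# 4)) ((γ :* γ :+ γ) :* Dˢ :- con (+ 2) :* (I :+ con (+ 2) :* γ) :* f³-aˢ) refl)
            (·₀ D≈0 +₀ -₀ ·₀ f³-a≈0)

  exceptional⇒singular : ∀ {a} → Exceptional K a → IsSingular K a
  exceptional⇒singular (inj₁ 4a+1≈0)        = 4a+1≈0⇒singular 4a+1≈0
  exceptional⇒singular (inj₂ (inj₁ a≈0))    = a≈0⇒singular a≈0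
  exceptional⇒singular (inj₂ (inj₂ critic)) = critical-value⇒singular critic

theorem4p3 : ∀ {c ℓ} (K : AlgClosedChar0Field c ℓ) (a : AlgClosedChar0Field.Carrier K) →
    IsAlgebraic K a → (IsSingular K a ⇔ Exceptional K a)
theorem4p3 K a _ = mk⇔ (singular⇒exceptional K) (exceptional⇒singular K)
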